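{- Let $(u,\dot u,\Sigma\dashv\Delta)$ be a generalized category with families over $\mathcal B$. Then there are adjoint functors $\overline{\Sigma}\dashv\overline{\Delta}$ such that $((u/u),(\Sigma/u),\overline{\Sigma}\dashv\overline{\Delta})$ is a generalized category with families over $\mathcal B$.
   Context: A generalized category with families consists of: a small category $\mathcal{B}$ with terminal object; Grothendieck fibrations $u\colon\mathcal{U}\to\mathcal{B}$ and $\dot u\colon\dot{\mathcal{U}}\to\mathcal{B}$; a fibration morphism $\Sigma\colon\dot{\mathcal U}\to\mathcal U$ (a functor with $u\Sigma=\dot u$ preserving cartesian arrows) which has a right adjoint functor $\Delta\colon\mathcal U\to\dot{\mathcal U}$ (not required to commute with the projections) such that every component of the unit is $\dot u$-cartesian and every component of the counit is $u$-cartesian. An arrow is $u$-vertical if $u$ sends it to an identity. The fibration $(u/u)$: its total category has objects triples $(f,A',A)$ with $f\colon A'\to A$ a $u$-vertical arrow of $\mathcal U$, morphisms $(f_1,A_1',A_1)\to(f_2,A_2',A_2)$ pairs $(h,k)$ of arrows of $\mathcal U$ with $kf_1=f_2h$, and it sends $(f,A',A)$ to $u(A)$. The fibration $(\Sigma/u)$: its total category has objects triples $(g,a,A)$ with $a\in\dot{\mathcal U}$, $A\in\mathcal U$ and $g\colon\Sigma a\to A$ a $u$-vertical arrow, morphisms $(g_1,a_1,A_1)\to(g_2,a_2,A_2)$ pairs $(m\colon a_1\to a_2,\ n\colon A_1\to A_2)$ with $n g_1=g_2\Sigma(m)$, and it sends $(g,a,A)$ to $u(A)=\dot u(a)$. 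-}

module Defs where

open import Level using (Level; _⊔_) renaming (suc to lsuc)
open import Data.Product using (Σ; Σ-syntax; _×_; _,_; proj₁; proj₂)
open import Relation.Binary using (IsEquivalence; Setoid)
open import Relation.Binary.PropositionalEquality using (_≡_; refl)
import Relation.Binary.Reasoning.Setoid as SetoidR

record Category (o ℓ e : Level) : Set (lsuc (o ⊔ ℓ ⊔ e)) where
  infix  4 _≈_
  infixr 9 _∘_
  field
    Obj       : Set o
    _⇒_       : Obj → Obj → Set ℓ
    _≈_       : ∀ {A B} → A ⇒ B → A ⇒ B → Set e
    id        : ∀ {A} → A ⇒ A
    _∘_       : ∀ {A B C} → B ⇒ C → A ⇒ B → A ⇒ C
    equiv     : ∀ {A B} → IsEquivalence (_≈_ {A} {B})
    assoc     : ∀ {A B C D} {f : A ⇒ B} {g : B ⇒ C} {h : C ⇒ D} →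
                (h ∘ g) ∘ f ≈ h ∘ (g ∘ f)
    identityˡ : ∀ {A B} {f : A ⇒ B} → id ∘ f ≈ f
    identityʳ : ∀ {A B} {f : A ⇒ B} → f ∘ id ≈ f
    ∘-resp-≈  : ∀ {A B C} {f h : B ⇒ C} {g i : A ⇒ B} →
                f ≈ h → g ≈ i → f ∘ g ≈ h ∘ i

  hom-setoid : Obj → Obj → Setoid ℓ e
  hom-setoid A B = record { Carrier = A ⇒ B ; _≈_ = _≈_ ; isEquivalence = equiv }

  hom-subst : ∀ {A A' B B'} → A ≡ A' → B ≡ B' → A ⇒ B → A' ⇒ B'
  hom-subst refl refl f = f

record Functor {o ℓ e o' ℓ' e'} (C : Category o ℓ e) (D : Category o' ℓ' e')
       : Set (o ⊔ ℓ ⊔ e ⊔ o' ⊔ ℓ' ⊔ e') where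
  private
    module C = Category C
    module D = Category D
  field
    F₀           : C.Obj → D.Obj
    F₁           : ∀ {A B} → A C.⇒ B → F₀ A D.⇒ F₀ B
    identity     : ∀ {A} → F₁ (C.id {A}) D.≈ D.id
    homomorphism : ∀ {X Y Z} {f : X C.⇒ Y} {g : Y C.⇒ Z} →
                   F₁ (g C.∘ f) D.≈ F₁ g D.∘ F₁ f
    F-resp-≈     : ∀ {A B} {f g : A C.⇒ B} → f C.≈ g → F₁ f D.≈ F₁ g

IdF : ∀ {o ℓ e} (C : Category o ℓ e) → Functor C C
IdF C = record
  { F₀ = λ A → A ; F₁ = λ f → f
  ; identity = IsEquivalence.refl equiv
  ; homomorphism = IsEquivalence.refl equiv
  ; F-resp-≈ = λ p → p }
  where open Category C

record Terminal {o ℓ e} (C : Category o ℓ e) : Set (o ⊔ ℓ ⊔ e) where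
  open Category C
  field
    ⊤        : Obj
    !        : ∀ {A} → A ⇒ ⊤
    !-unique : ∀ {A} (f : A ⇒ ⊤) → ! ≈ f

module _ {o ℓ e o' ℓ' e'} {E : Category o ℓ e} {B : Category o' ℓ' e'}
         (p : Functor E B) where
  private
    module E = Category E
    module B = Category B
  open Functor p

  IsVertical : ∀ {X Y} → X E.⇒ Y → Set (o' ⊔ e')
  IsVertical {X} {Y} f =
    Σ[ q ∈ F₀ X ≡ F₀ Y ] (B.hom-subst q refl (F₁ f) B.≈ B.id)

  IsCartesian : ∀ {X Y} → X E.⇒ Y → Set (o ⊔ ℓ ⊔ e ⊔ ℓ' ⊔ e')
  IsCartesian {X} {Y} f =
    ∀ {Z} (g : Z E.⇒ Y) (v : F₀ Z B.⇒ F₀ X) → F₁ f B.∘ v B.≈ F₁ g →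
    Σ[ h ∈ Z E.⇒ X ] ((F₁ h B.≈ v) × (f E.∘ h E.≈ g)
      × (∀ (h' : Z E.⇒ X) → F₁ h' B.≈ v → f E.∘ h' E.≈ g → h' E.≈ h))

  IsFibration : Set (o ⊔ ℓ ⊔ e ⊔ o' ⊔ ℓ' ⊔ e')
  IsFibration =
    ∀ (Y : E.Obj) {b : B.Obj} (σ : b B.⇒ F₀ Y) →
    Σ[ X ∈ E.Obj ] Σ[ f ∈ X E.⇒ Y ] Σ[ q ∈ F₀ X ≡ b ]
      ((B.hom-subst q refl (F₁ f) B.≈ σ) × IsCartesian f)

record Adjunction {o ℓ e o' ℓ' e'} {C : Category o ℓ e} {D : Category o' ℓ' e'}
       (L : Functor C D) (R : Functor D C) : Set (o ⊔ ℓ ⊔ e ⊔ o' ⊔ ℓ' ⊔ e') where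
  private
    module C = Category C
    module D = Category D
    module L = Functor L
    module R = Functor R
  field
    η          : ∀ (X : C.Obj) → X C.⇒ R.F₀ (L.F₀ X)
    ε          : ∀ (Y : D.Obj) → L.F₀ (R.F₀ Y) D.⇒ Y
    η-natural  : ∀ {X X'} (f : X C.⇒ X') →
                 η X' C.∘ f C.≈ R.F₁ (L.F₁ f) C.∘ η X
    ε-natural  : ∀ {Y Y'} (g : Y D.⇒ Y') →
                 ε Y' D.∘ L.F₁ (R.F₁ g) D.≈ g D.∘ ε Y
    zig        : ∀ {X} → ε (L.F₀ X) D.∘ L.F₁ (η X) D.≈ D.id
    zag        : ∀ {Y} → R.F₁ (ε Y) C.∘ η (R.F₀ Y) C.≈ C.id

module _ {ob ℓb eb ou ℓu eu ou̇ ℓu̇ eu̇}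
         (B : Category ob ℓb eb) {U : Category ou ℓu eu} {U̇ : Category ou̇ ℓu̇ eu̇}
         (u : Functor U B) (u̇ : Functor U̇ B)
         (Σ' : Functor U̇ U) (Δ : Functor U U̇) (adj : Adjunction Σ' Δ) where
  private
    module B  = Category B
    module U  = Category U
    module U̇ = Category U̇
    module u  = Functor u
    module u̇ = Functor u̇
    module Σ' = Functor Σ'
    open Adjunction adj

  record IsGCwF : Set (ob ⊔ ℓb ⊔ eb ⊔ ou ⊔ ℓu ⊔ eu ⊔ ou̇ ⊔ ℓu̇ ⊔ eu̇) where
    field
      terminal     : Terminal B
      u-fibration  : IsFibration u
      u̇-fibration  : IsFibration u̇
      Σ-over₀      : ∀ (a : U̇.Obj) → u.F₀ (Σ'.F₀ a) ≡ u̇.F₀ a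
      Σ-over₁      : ∀ {a a'} (m : a U̇.⇒ a') →
                     B.hom-subst (Σ-over₀ a) (Σ-over₀ a') (u.F₁ (Σ'.F₁ m)) B.≈ u̇.F₁ m
      Σ-cartesian  : ∀ {a a'} (m : a U̇.⇒ a') → IsCartesian u̇ m → IsCartesian u (Σ'.F₁ m)
      unit-cart    : ∀ (a : U̇.Obj) → IsCartesian u̇ (η a)
      counit-cart  : ∀ (A : U.Obj) → IsCartesian u (ε A)

-- VComma p F : objects (a , X , g , _) with g : F a → X a p-vertical arrow,
-- morphisms (m , n) with n ∘ g₁ ≈ g₂ ∘ F m.
-- (u/u) = VComma u (IdF U), (Σ/u) = VComma u Σ.

module _ {oa ℓa ea oc ℓc ec od ℓd ed}
         {A : Category oa ℓa ea} {C : Category oc ℓc ec} {D : Category od ℓd ed}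
         (p : Functor C D) (F : Functor A C) where
  private
    module A = Category A
    module C = Category C
    module D = Category D
    module F = Functor F
    module p = Functor p

  record VObj : Set (oa ⊔ oc ⊔ ℓc ⊔ od ⊔ ed) where
    constructor vobj
    field
      dom  : A.Obj
      cod  : C.Obj
      arr  : F.F₀ dom C.⇒ cod
      vert : IsVertical p arr

  record VHom (x y : VObj) : Set (ℓa ⊔ ℓc ⊔ ec) where
    constructor vhom
    private
      module x = VObj x
      module y = VObj y
    field
      top  : x.dom A.⇒ y.dom
      bot  : x.cod C.⇒ y.cod
      comm : bot C.∘ x.arr C.≈ y.arr C.∘ F.F₁ top

  private
    module CE {X Y} = IsEquivalence (C.equiv {X} {Y})
    module AE {X Y} = IsEquivalence (A.equiv {X} {Y})

    vid : ∀ {x} → VHom x x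
    vid {x} = vhom A.id C.id
      (CE.trans C.identityˡ (CE.trans (CE.sym C.identityʳ)
        (C.∘-resp-≈ CE.refl (CE.sym F.identity))))

    vcomp : ∀ {x y z} → VHom y z → VHom x y → VHom x z
    vcomp {x} {y} {z} (vhom m₂ n₂ c₂) (vhom m₁ n₁ c₁) = vhom (m₂ A.∘ m₁) (n₂ C.∘ n₁) pf
      where
      open SetoidR (C.hom-setoid _ _)
      pf : (n₂ C.∘ n₁) C.∘ VObj.arr x C.≈ VObj.arr z C.∘ F.F₁ (m₂ A.∘ m₁)
      pf = begin
        (n₂ C.∘ n₁) C.∘ VObj.arr x            ≈⟨ C.assoc ⟩
        n₂ C.∘ (n₁ C.∘ VObj.arr x)            ≈⟨ C.∘-resp-≈ CE.refl c₁ ⟩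
        n₂ C.∘ (VObj.arr y C.∘ F.F₁ m₁)       ≈⟨ CE.sym C.assoc ⟩
        (n₂ C.∘ VObj.arr y) C.∘ F.F₁ m₁       ≈⟨ C.∘-resp-≈ c₂ CE.refl ⟩
        (VObj.arr z C.∘ F.F₁ m₂) C.∘ F.F₁ m₁  ≈⟨ C.assoc ⟩
        VObj.arr z C.∘ (F.F₁ m₂ C.∘ F.F₁ m₁)  ≈⟨ C.∘-resp-≈ CE.refl (CE.sym F.homomorphism) ⟩
        VObj.arr z C.∘ F.F₁ (m₂ A.∘ m₁)       ∎

  VComma : Category (oa ⊔ oc ⊔ ℓc ⊔ od ⊔ ed) (ℓa ⊔ ℓc ⊔ ec) (ea ⊔ ec)
  VComma = record
    { Obj = VObj
    ; _⇒_ = VHom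
    ; _≈_ = λ f g → (VHom.top f A.≈ VHom.top g) × (VHom.bot f C.≈ VHom.bot g)
    ; id = vid
    ; _∘_ = vcomp
    ; equiv = record
      { refl = AE.refl , CE.refl
      ; sym = λ (a , b) → AE.sym a , CE.sym b
      ; trans = λ (a , b) (c , d) → AE.trans a c , CE.trans b d }
    ; assoc = A.assoc , C.assoc
    ; identityˡ = A.identityˡ , C.identityˡ
    ; identityʳ = A.identityʳ , C.identityʳ
    ; ∘-resp-≈ = λ (a , b) (c , d) → A.∘-resp-≈ a c , C.∘-resp-≈ b d
    }

  VCommaProj : Functor VComma D
  VCommaProj = record
    { F₀ = λ x → p.F₀ (VObj.cod x)
    ; F₁ = λ f → p.F₁ (VHom.bot f)
    ; identity = p.identity
    ; homomorphism = p.homomorphism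
    ; F-resp-≈ = λ (_ , b) → p.F-resp-≈ b
    }

{-# OPTIONS --safe #-}
-- For a vertical f : A' → A,
-- let c : A* → A be a cartesian lift of u(ε A'); then f ∘ ε A' factors as c ∘ g with
-- g : ΣΔA' → A* vertical, and Δ̄ f = (g, ΔA', A*). The counit is (ε A', c); the unit,
-- the action of Δ̄ on morphisms, and every equation between them are obtained by
-- factoring through these cartesian lifts, so everything reduces to uniqueness of such
-- factorisations together with the adjunction laws of Σ ⊣ Δ. In both vertical comma
-- categories an arrow is cartesian iff both its components are, which yields the two
-- fibrations, the cartesianness of unit and counit, and the preservation of cartesian
-- arrows by Σ̄ (from that of Σ).
module Submission where

open import Defs
open import Level using (Level; _⊔_)
open import Data.Product using (Σ-syntax; _×_; _,_; proj₁; proj₂)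
open import Relation.Binary using (IsEquivalence)
open import Relation.Binary.PropositionalEquality using (_≡_; refl; sym; trans)
import Relation.Binary.Reasoning.Setoid as SetoidR

_∘F_ : ∀ {o ℓ e o' ℓ' e' o'' ℓ'' e''}
         {C : Category o ℓ e} {D : Category o' ℓ' e'} {E : Category o'' ℓ'' e''} →
       Functor D E → Functor C D → Functor C E
_∘F_ {E = E} G F = record
  { F₀ = λ X → G.F₀ (F.F₀ X)
  ; F₁ = λ f → G.F₁ (F.F₁ f)
  ; identity = IsEquivalence.trans E.equiv (G.F-resp-≈ F.identity) G.identity
  ; homomorphism = IsEquivalence.trans E.equiv (G.F-resp-≈ F.homomorphism) G.homomorphism
  ; F-resp-≈ = λ p → G.F-resp-≈ (F.F-resp-≈ p)
  }
  where
  module E = Category E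
  module F = Functor F
  module G = Functor G

record Iso {o ℓ e} (C : Category o ℓ e) (X Y : Category.Obj C) : Set (ℓ ⊔ e) where
  open Category C
  field
    from  : X ⇒ Y
    to    : Y ⇒ X
    isoˡ  : to ∘ from ≈ id
    isoʳ  : from ∘ to ≈ id

-- Cartesian lifts only fix their base objects up to ≡, so arrows of the base
-- are compared across propositionally equal endpoints.
module HomEq {o ℓ e} (B : Category o ℓ e) where
  open Category B
  private module BE {X Y} = IsEquivalence (equiv {X} {Y})

  infix 4 _≈̂_
  record _≈̂_ {P Q P' Q'} (f : P ⇒ Q) (g : P' ⇒ Q') : Set (o ⊔ e) where
    constructor heq
    field
      dom-≡ : P ≡ P'
      cod-≡ : Q ≡ Q'
      eq    : hom-subst dom-≡ cod-≡ f ≈ g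

  open _≈̂_ public

  ≈⇒≈̂ : ∀ {P Q} {f g : P ⇒ Q} → f ≈ g → f ≈̂ g
  ≈⇒≈̂ = heq refl refl

  ≈̂⇒≈ : ∀ {P Q} {f g : P ⇒ Q} → f ≈̂ g → f ≈ g
  ≈̂⇒≈ (heq refl refl f≈g) = f≈g

  ≈̂-refl : ∀ {P Q} {f : P ⇒ Q} → f ≈̂ f
  ≈̂-refl = ≈⇒≈̂ BE.refl

  ≈̂-sym : ∀ {P Q P' Q'} {f : P ⇒ Q} {g : P' ⇒ Q'} → f ≈̂ g → g ≈̂ f
  ≈̂-sym (heq refl refl f≈g) = ≈⇒≈̂ (BE.sym f≈g)

  ≈̂-trans : ∀ {P Q P' Q' P'' Q''} {f : P ⇒ Q} {g : P' ⇒ Q'} {h : P'' ⇒ Q''} →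
            f ≈̂ g → g ≈̂ h → f ≈̂ h
  ≈̂-trans (heq refl refl f≈g) (heq refl refl g≈h) = ≈⇒≈̂ (BE.trans f≈g g≈h)

  ∘-resp-≈̂ : ∀ {P Q R P' Q' R'} {f : Q ⇒ R} {g : P ⇒ Q} {f' : Q' ⇒ R'} {g' : P' ⇒ Q'} →
             f ≈̂ f' → g ≈̂ g' → f ∘ g ≈̂ f' ∘ g'
  ∘-resp-≈̂ (heq refl refl f≈f') (heq refl refl g≈g') = ≈⇒≈̂ (∘-resp-≈ f≈f' g≈g')

  hom-subst-≈̂ : ∀ {P Q P' Q'} (p : P ≡ P') (q : Q ≡ Q') (f : P ⇒ Q) → hom-subst p q f ≈̂ f
  hom-subst-≈̂ refl refl f = ≈̂-refl

  id-≈̂ : ∀ {P P'} → P ≡ P' → id {P} ≈̂ id {P'}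
  id-≈̂ refl = ≈̂-refl

  identityˡ̂ : ∀ {P Q} {f : P ⇒ Q} → id ∘ f ≈̂ f
  identityˡ̂ = ≈⇒≈̂ identityˡ

  identityʳ̂ : ∀ {P Q} {f : P ⇒ Q} → f ∘ id ≈̂ f
  identityʳ̂ = ≈⇒≈̂ identityʳ

  infixr 2 _≈̂⟨_⟩_
  infix  3 _∎̂
  _≈̂⟨_⟩_ : ∀ {P Q P' Q' P'' Q''} (f : P ⇒ Q) {g : P' ⇒ Q'} {h : P'' ⇒ Q''} →
           f ≈̂ g → g ≈̂ h → f ≈̂ h
  f ≈̂⟨ f≈̂g ⟩ g≈̂h = ≈̂-trans f≈̂g g≈̂h

  _∎̂ : ∀ {P Q} (f : P ⇒ Q) → f ≈̂ f
  f ∎̂ = ≈̂-refl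

module Fibred {o ℓ e o' ℓ' e'} {E : Category o ℓ e} {B : Category o' ℓ' e'}
              (P : Functor E B) where
  private
    module E = Category E
    module B = Category B
    module EE {X Y} = IsEquivalence (E.equiv {X} {Y})
    module BE {X Y} = IsEquivalence (B.equiv {X} {Y})
  open Functor P
  open HomEq B

  homomorphism̂ : ∀ {X Y Z} {f : X E.⇒ Y} {g : Y E.⇒ Z} → F₁ (g E.∘ f) ≈̂ F₁ g B.∘ F₁ f
  homomorphism̂ = ≈⇒≈̂ homomorphism

  identitŷ : ∀ {X} → F₁ (E.id {X}) ≈̂ B.id {F₀ X}
  identitŷ = ≈⇒≈̂ identity

  vertical⇒≈̂id : ∀ {X Y} {f : X E.⇒ Y} → IsVertical P f → F₁ f ≈̂ B.id {F₀ Y}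
  vertical⇒≈̂id (r , f≈id) = heq r refl f≈id

  vertical⇒≈̂idˡ : ∀ {X Y} {f : X E.⇒ Y} → IsVertical P f → F₁ f ≈̂ B.id {F₀ X}
  vertical⇒≈̂idˡ f-vert@(r , _) = ≈̂-trans (vertical⇒≈̂id f-vert) (id-≈̂ (sym r))

  ≈̂id⇒vertical : ∀ {X Y} {f : X E.⇒ Y} {b} → F₁ f ≈̂ B.id {b} → IsVertical P f
  ≈̂id⇒vertical (heq r refl f≈id) = r , f≈id

  F₁-∘-verticalʳ : ∀ {X Y Z} {g : X E.⇒ Y} {f : Y E.⇒ Z} →
                   IsVertical P g → F₁ (f E.∘ g) ≈̂ F₁ f
  F₁-∘-verticalʳ g-vert =
    ≈̂-trans homomorphism̂ (≈̂-trans (∘-resp-≈̂ ≈̂-refl (vertical⇒≈̂id g-vert)) identityʳ̂)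

  F₁-∘-verticalˡ : ∀ {X Y Z} {f : X E.⇒ Y} {g : Y E.⇒ Z} →
                   IsVertical P g → F₁ (g E.∘ f) ≈̂ F₁ f
  F₁-∘-verticalˡ g-vert =
    ≈̂-trans homomorphism̂ (≈̂-trans (∘-resp-≈̂ (vertical⇒≈̂idˡ g-vert) ≈̂-refl) identityˡ̂)

  record CartesianLift (Y : E.Obj) {b} (σ : b B.⇒ F₀ Y) : Set (o ⊔ ℓ ⊔ e ⊔ o' ⊔ ℓ' ⊔ e') where
    field
      {obj}     : E.Obj
      arr       : obj E.⇒ Y
      over      : F₁ arr ≈̂ σ
      cartesian : IsCartesian P arr

  cartesianLift : IsFibration P → ∀ Y {b} (σ : b B.⇒ F₀ Y) → CartesianLift Y σ
  cartesianLift fib Y σ with fib Y σ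
  ... | _ , f , q , f-over , f-cart = record { arr = f ; over = heq q refl f-over ; cartesian = f-cart }

  cartesianLift⇒isFibration : (∀ Y {b} (σ : b B.⇒ F₀ Y) → CartesianLift Y σ) → IsFibration P
  cartesianLift⇒isFibration lift Y σ with lift Y σ
  ... | record { arr = f ; over = heq q refl f-over ; cartesian = f-cart } = _ , f , q , f-over , f-cart

  record Factorisation {X Y Z} (c : X E.⇒ Y) (g : Z E.⇒ Y) {b b'} (w : b B.⇒ b')
         : Set (ℓ ⊔ e ⊔ o' ⊔ e') where
    field
      arr     : Z E.⇒ X
      over    : F₁ arr ≈̂ w
      factors : c E.∘ arr E.≈ g

  factorise : ∀ {X Y Z b b' y'} {c : X E.⇒ Y} {k : b' B.⇒ y'} → IsCartesian P c → F₁ c ≈̂ k →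
              (g : Z E.⇒ Y) {w : b B.⇒ b'} → k B.∘ w ≈̂ F₁ g → Factorisation c g w
  factorise c-cart (heq refl refl c≈k) g {w} (heq refl refl kw≈g)
    with c-cart g w (BE.trans (B.∘-resp-≈ c≈k BE.refl) kw≈g)
  ... | h , h-over , h-factors , _ = record { arr = h ; over = ≈⇒≈̂ h-over ; factors = h-factors }

  cartesian-unique : ∀ {X Y Z} {f : X E.⇒ Y} → IsCartesian P f → {h₁ h₂ : Z E.⇒ X} →
                     F₁ h₁ ≈̂ F₁ h₂ → f E.∘ h₁ E.≈ f E.∘ h₂ → h₁ E.≈ h₂
  cartesian-unique {f = f} f-cart {h₁} {h₂} h₁≈̂h₂ fh₁≈fh₂
    with f-cart (f E.∘ h₁) (F₁ h₁) (BE.sym homomorphism)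
  ... | _ , _ , _ , unique =
    EE.trans (unique h₁ BE.refl EE.refl) (EE.sym (unique h₂ (BE.sym (≈̂⇒≈ h₁≈̂h₂)) (EE.sym fh₁≈fh₂)))

  cartesian-resp-≈ : ∀ {X Y} {f f' : X E.⇒ Y} → f E.≈ f' → IsCartesian P f → IsCartesian P f'
  cartesian-resp-≈ f≈f' f-cart g v fv≈g
    with f-cart g v (BE.trans (B.∘-resp-≈ (F-resp-≈ f≈f') BE.refl) fv≈g)
  ... | h , h-over , fh≈g , unique =
    h , h-over , EE.trans (E.∘-resp-≈ (EE.sym f≈f') EE.refl) fh≈g ,
    λ h' h'-over f'h'≈g → unique h' h'-over (EE.trans (E.∘-resp-≈ f≈f' EE.refl) f'h'≈g)

  id-cartesian : ∀ {X} → IsCartesian P (E.id {X})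
  id-cartesian g v idv≈g =
    g , BE.trans (BE.sym idv≈g) (BE.trans (B.∘-resp-≈ identity BE.refl) B.identityˡ) ,
    E.identityˡ , λ h' _ idh'≈g → EE.trans (EE.sym E.identityˡ) idh'≈g

  cartesian-∘-iso : ∀ {X X₀ Y} {f₀ : X₀ E.⇒ Y} → IsCartesian P f₀ →
                    (φ : Iso E X X₀) → IsCartesian P (f₀ E.∘ Iso.from φ)
  cartesian-∘-iso {f₀ = f₀} f₀-cart φ g v f₀φv≈g
    with f₀-cart g (F₁ from B.∘ v)
           (BE.trans (BE.sym B.assoc) (BE.trans (B.∘-resp-≈ (BE.sym homomorphism) BE.refl) f₀φv≈g))
    where open Iso φ
  ... | h₀ , h₀-over , f₀h₀≈g , unique = to E.∘ h₀ , h-over , fh≈g , h-unique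
    where
    open Iso φ
    h-over : F₁ (to E.∘ h₀) B.≈ v
    h-over = begin
      F₁ (to E.∘ h₀)            ≈⟨ homomorphism ⟩
      F₁ to B.∘ F₁ h₀           ≈⟨ B.∘-resp-≈ BE.refl h₀-over ⟩
      F₁ to B.∘ (F₁ from B.∘ v) ≈⟨ BE.sym B.assoc ⟩
      (F₁ to B.∘ F₁ from) B.∘ v ≈⟨ B.∘-resp-≈ (BE.sym homomorphism) BE.refl ⟩
      F₁ (to E.∘ from) B.∘ v    ≈⟨ B.∘-resp-≈ (BE.trans (F-resp-≈ isoˡ) identity) BE.refl ⟩
      B.id B.∘ v                ≈⟨ B.identityˡ ⟩
      v                         ∎
      where open SetoidR (B.hom-setoid _ _)
    fh≈g : (f₀ E.∘ from) E.∘ (to E.∘ h₀) E.≈ g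
    fh≈g = begin
      (f₀ E.∘ from) E.∘ (to E.∘ h₀) ≈⟨ E.assoc ⟩
      f₀ E.∘ (from E.∘ (to E.∘ h₀)) ≈⟨ E.∘-resp-≈ EE.refl (EE.sym E.assoc) ⟩
      f₀ E.∘ ((from E.∘ to) E.∘ h₀) ≈⟨ E.∘-resp-≈ EE.refl (E.∘-resp-≈ isoʳ EE.refl) ⟩
      f₀ E.∘ (E.id E.∘ h₀)          ≈⟨ E.∘-resp-≈ EE.refl E.identityˡ ⟩
      f₀ E.∘ h₀                     ≈⟨ f₀h₀≈g ⟩
      g                             ∎
      where open SetoidR (E.hom-setoid _ _)
    h-unique : ∀ h' → F₁ h' B.≈ v → (f₀ E.∘ from) E.∘ h' E.≈ g → h' E.≈ to E.∘ h₀
    h-unique h' h'-over fh'≈g = begin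
      h'                   ≈⟨ EE.sym E.identityˡ ⟩
      E.id E.∘ h'          ≈⟨ E.∘-resp-≈ (EE.sym isoˡ) EE.refl ⟩
      (to E.∘ from) E.∘ h' ≈⟨ E.assoc ⟩
      to E.∘ (from E.∘ h') ≈⟨ E.∘-resp-≈ EE.refl (unique (from E.∘ h')
                                  (BE.trans homomorphism (B.∘-resp-≈ BE.refl h'-over))
                                  (EE.trans (EE.sym E.assoc) fh'≈g)) ⟩
      to E.∘ h₀              ∎
      where open SetoidR (E.hom-setoid _ _)

  cartesian-cancelˡ : ∀ {X Y Z} {c : Y E.⇒ Z} {f : X E.⇒ Y} →
                      IsCartesian P c → IsCartesian P (c E.∘ f) → IsCartesian P f
  cartesian-cancelˡ {c = c} {f} c-cart cf-cart g v fv≈g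
    with cf-cart (c E.∘ g) v (BE.trans (B.∘-resp-≈ homomorphism BE.refl)
           (BE.trans B.assoc (BE.trans (B.∘-resp-≈ BE.refl fv≈g) (BE.sym homomorphism))))
  ... | h , h-over , cfh≈cg , unique =
    h , h-over , fh≈g ,
    λ h' h'-over fh'≈g → unique h' h'-over (EE.trans E.assoc (E.∘-resp-≈ EE.refl fh'≈g))
    where
    fh≈g : f E.∘ h E.≈ g
    fh≈g = cartesian-unique c-cart
      (≈̂-trans homomorphism̂ (≈̂-trans (∘-resp-≈̂ ≈̂-refl (≈⇒≈̂ h-over)) (≈⇒≈̂ fv≈g)))
      (EE.trans (EE.sym E.assoc) cfh≈cg)

  -- Each of two cartesian arrows over the same base arrow factors the other
  -- over an identity; uniqueness of factorisations makes these mutually inverse.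
  cartesian-unique-up-to-iso :
    ∀ {X X₀ Y} {f : X E.⇒ Y} {f₀ : X₀ E.⇒ Y} → IsCartesian P f → IsCartesian P f₀ →
    F₁ f ≈̂ F₁ f₀ → Σ[ φ ∈ Iso E X X₀ ] (f₀ E.∘ Iso.from φ E.≈ f)
  cartesian-unique-up-to-iso {X} {X₀} {f = f} {f₀} f-cart f₀-cart f≈̂f₀ =
    record { from = φ.arr ; to = ψ.arr ; isoˡ = isoˡ ; isoʳ = isoʳ } , φ.factors
    where
    module φ = Factorisation (factorise f₀-cart (≈̂-sym f≈̂f₀) f {B.id} identityʳ̂)
    module ψ = Factorisation (factorise f-cart ≈̂-refl f₀ {B.id} (≈̂-trans identityʳ̂ f≈̂f₀))
    over-id : ∀ {Z Z'} {h : Z E.⇒ Z'} → F₁ h ≈̂ B.id {F₀ X} → F₁ h ≈̂ F₁ (E.id {Z})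
    over-id h≈̂id = ≈̂-trans h≈̂id (≈̂-trans (id-≈̂ (sym (dom-≡ h≈̂id))) (≈̂-sym identitŷ))
    isoˡ : ψ.arr E.∘ φ.arr E.≈ E.id
    isoˡ = cartesian-unique f-cart
      (over-id (≈̂-trans homomorphism̂ (≈̂-trans (∘-resp-≈̂ ψ.over φ.over) identityˡ̂)))
      (EE.trans (EE.sym E.assoc)
        (EE.trans (E.∘-resp-≈ ψ.factors EE.refl) (EE.trans φ.factors (EE.sym E.identityʳ))))
    isoʳ : φ.arr E.∘ ψ.arr E.≈ E.id
    isoʳ = cartesian-unique f₀-cart
      (over-id (≈̂-trans homomorphism̂ (≈̂-trans (∘-resp-≈̂ φ.over ψ.over) identityˡ̂)))
      (EE.trans (EE.sym E.assoc)
        (EE.trans (E.∘-resp-≈ φ.factors EE.refl) (EE.trans ψ.factors (EE.sym E.identityʳ))))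

module VerticalComma {ob ℓb eb ou ℓu eu oa ℓa ea}
  (B : Category ob ℓb eb) {U : Category ou ℓu eu} {A : Category oa ℓa ea}
  (u : Functor U B) (p : Functor A B) (F : Functor A U)
  (F-over : ∀ {a a'} (m : Category._⇒_ A a a') →
            HomEq._≈̂_ B (Functor.F₁ u (Functor.F₁ F m)) (Functor.F₁ p m)) where
  private
    module B = Category B
    module U = Category U
    module A = Category A
    module u = Functor u
    module p = Functor p
    module F = Functor F
    module UE {X Y} = IsEquivalence (U.equiv {X} {Y})
    module AE {X Y} = IsEquivalence (A.equiv {X} {Y})
    module V = Category (VComma u F)
    module Fu = Fibred u
    module Fp = Fibred p
  open HomEq B
  open VObj using (dom; cod; arr; vert)
  open VHom using (top; bot)

  private
    Proj : Functor (VComma u F) B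
    Proj = VCommaProj u F

    module FProj = Fibred Proj

  cod-over-dom : ∀ (x : VObj u F) → u.F₀ (cod x) ≡ p.F₀ (dom x)
  cod-over-dom x = trans (sym (proj₁ (vert x))) (dom-≡ (F-over (A.id {dom x})))

  bot-≈̂-F₁-top : ∀ {x y} (f : VHom u F x y) → u.F₁ (bot f) ≈̂ u.F₁ (F.F₁ (top f))
  bot-≈̂-F₁-top {x} {y} (vhom m n n∘gx≈gy∘m) =
    u.F₁ n                  ≈̂⟨ ≈̂-sym (Fu.F₁-∘-verticalʳ (vert x)) ⟩
    u.F₁ (n U.∘ arr x)      ≈̂⟨ ≈⇒≈̂ (u.F-resp-≈ n∘gx≈gy∘m) ⟩
    u.F₁ (arr y U.∘ F.F₁ m) ≈̂⟨ Fu.F₁-∘-verticalˡ (vert y) ⟩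
    u.F₁ (F.F₁ m)           ∎̂

  bot-≈̂-top : ∀ {x y} (f : VHom u F x y) → u.F₁ (bot f) ≈̂ p.F₁ (top f)
  bot-≈̂-top f = ≈̂-trans (bot-≈̂-F₁-top f) (F-over (top f))

  vhom-cartesian : ∀ {x y} (f : VHom u F x y) →
                   IsCartesian p (top f) → IsCartesian u (bot f) → IsCartesian Proj f
  vhom-cartesian {x} {y} f@(vhom m n n∘gx≈gy∘m) m-cart n-cart {z} g@(vhom m₂ n₂ n₂∘gz≈gy∘m₂) v nv≈n₂
    with n-cart n₂ v nv≈n₂
  ... | n' , n'-over , nn'≈n₂ , n-unique = vhom m' n' comm , n'-over , (M.factors , nn'≈n₂) , unique
    where
    module M = Fp.Factorisation
      (Fp.factorise m-cart (≈̂-sym (bot-≈̂-top f)) m₂ (≈̂-trans (≈⇒≈̂ nv≈n₂) (bot-≈̂-top g)))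
    m' = M.arr
    comm : n' U.∘ arr z U.≈ arr x U.∘ F.F₁ m'
    comm = Fu.cartesian-unique n-cart
      (u.F₁ (n' U.∘ arr z)      ≈̂⟨ Fu.F₁-∘-verticalʳ (vert z) ⟩
       u.F₁ n'                  ≈̂⟨ ≈̂-trans (≈⇒≈̂ n'-over) (≈̂-sym M.over) ⟩
       p.F₁ m'                  ≈̂⟨ ≈̂-sym (F-over m') ⟩
       u.F₁ (F.F₁ m')           ≈̂⟨ ≈̂-sym (Fu.F₁-∘-verticalˡ (vert x)) ⟩
       u.F₁ (arr x U.∘ F.F₁ m') ∎̂)
      (begin
        n U.∘ (n' U.∘ arr z)           ≈⟨ UE.sym U.assoc ⟩
        (n U.∘ n') U.∘ arr z           ≈⟨ U.∘-resp-≈ nn'≈n₂ UE.refl ⟩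
        n₂ U.∘ arr z                   ≈⟨ n₂∘gz≈gy∘m₂ ⟩
        arr y U.∘ F.F₁ m₂              ≈⟨ U.∘-resp-≈ UE.refl (F.F-resp-≈ (AE.sym M.factors)) ⟩
        arr y U.∘ F.F₁ (m A.∘ m')      ≈⟨ U.∘-resp-≈ UE.refl F.homomorphism ⟩
        arr y U.∘ (F.F₁ m U.∘ F.F₁ m') ≈⟨ UE.sym U.assoc ⟩
        (arr y U.∘ F.F₁ m) U.∘ F.F₁ m' ≈⟨ U.∘-resp-≈ (UE.sym n∘gx≈gy∘m) UE.refl ⟩
        (n U.∘ arr x) U.∘ F.F₁ m'      ≈⟨ U.assoc ⟩
        n U.∘ (arr x U.∘ F.F₁ m')      ∎)
      where open SetoidR (U.hom-setoid _ _)
    unique : ∀ (h : VHom u F z x) → u.F₁ (bot h) B.≈ v → f V.∘ h V.≈ g → h V.≈ vhom m' n' comm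
    unique h h-over (mh≈m₂ , nh≈n₂) =
      Fp.cartesian-unique m-cart
        (≈̂-trans (≈̂-sym (bot-≈̂-top h)) (≈̂-trans (≈⇒≈̂ h-over) (≈̂-sym M.over)))
        (AE.trans mh≈m₂ (AE.sym M.factors)) ,
      n-unique (bot h) h-over nh≈n₂

  module _ (p-fib : IsFibration p) (u-fib : IsFibration u) where

    record ComponentwiseLift (y : VObj u F) {b} (σ : b B.⇒ u.F₀ (cod y))
           : Set (oa ⊔ ℓa ⊔ ea ⊔ ou ⊔ ℓu ⊔ eu ⊔ ob ⊔ ℓb ⊔ eb) where
      field
        {obj}         : VObj u F
        arr           : VHom u F obj y
        over          : u.F₁ (bot arr) ≈̂ σ
        top-cartesian : IsCartesian p (top arr)
        bot-cartesian : IsCartesian u (bot arr)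

    componentwiseLift : ∀ y {b} (σ : b B.⇒ u.F₀ (cod y)) → ComponentwiseLift y σ
    componentwiseLift y@(vobj a X g g-vert) {b} σ = record
      { obj = vobj _ _ G.arr (Fu.≈̂id⇒vertical G.over)
      ; arr = vhom M.arr N.arr G.factors
      ; over = N.over
      ; top-cartesian = M.cartesian
      ; bot-cartesian = N.cartesian
      }
      where
      σ' : b B.⇒ p.F₀ a
      σ' = B.hom-subst refl (cod-over-dom y) σ
      module N = Fu.CartesianLift (Fu.cartesianLift u-fib X σ)
      module M = Fp.CartesianLift (Fp.cartesianLift p-fib a σ')
      module G = Fu.Factorisation (Fu.factorise N.cartesian N.over (g U.∘ F.F₁ M.arr) {B.id}
        (σ B.∘ B.id              ≈̂⟨ identityʳ̂ ⟩
         σ                       ≈̂⟨ ≈̂-sym (hom-subst-≈̂ refl (cod-over-dom y) σ) ⟩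
         σ'                      ≈̂⟨ ≈̂-sym M.over ⟩
         p.F₁ M.arr              ≈̂⟨ ≈̂-sym (F-over M.arr) ⟩
         u.F₁ (F.F₁ M.arr)       ≈̂⟨ ≈̂-sym (Fu.F₁-∘-verticalˡ g-vert) ⟩
         u.F₁ (g U.∘ F.F₁ M.arr) ∎̂))

    isFibration : IsFibration Proj
    isFibration = FProj.cartesianLift⇒isFibration λ y σ →
      let module L = ComponentwiseLift (componentwiseLift y σ) in
      record { arr = L.arr ; over = L.over
             ; cartesian = vhom-cartesian L.arr L.top-cartesian L.bot-cartesian }

    -- A cartesian arrow is isomorphic to the componentwise lift of its base arrow.
    cartesian⇒top-cartesian×bot-cartesian :
      ∀ {x y} {f : VHom u F x y} → IsCartesian Proj f →
      IsCartesian p (top f) × IsCartesian u (bot f)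
    cartesian⇒top-cartesian×bot-cartesian {x} {y} {f} f-cart =
      Fp.cartesian-resp-≈ (proj₁ f₀φ≈f) (Fp.cartesian-∘-iso L.top-cartesian topIso) ,
      Fu.cartesian-resp-≈ (proj₂ f₀φ≈f) (Fu.cartesian-∘-iso L.bot-cartesian botIso)
      where
      module L = ComponentwiseLift (componentwiseLift y (u.F₁ (bot f)))
      comparison : Σ[ φ ∈ Iso (VComma u F) x L.obj ] (L.arr V.∘ Iso.from φ V.≈ f)
      comparison = FProj.cartesian-unique-up-to-iso {f = f} {f₀ = L.arr} f-cart
        (vhom-cartesian L.arr L.top-cartesian L.bot-cartesian) (≈̂-sym L.over)
      open Iso (proj₁ comparison)
      f₀φ≈f : L.arr V.∘ from V.≈ f
      f₀φ≈f = proj₂ comparison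
      topIso : Iso A _ _
      topIso = record { from = top from ; to = top to ; isoˡ = proj₁ isoˡ ; isoʳ = proj₁ isoʳ }
      botIso : Iso U _ _
      botIso = record { from = bot from ; to = bot to ; isoˡ = proj₂ isoˡ ; isoʳ = proj₂ isoʳ }

module VerticalArrowCwF {ob ℓb eb ou ℓu eu ou̇ ℓu̇ eu̇ : Level}
  {B : Category ob ℓb eb} {U : Category ou ℓu eu} {U̇ : Category ou̇ ℓu̇ eu̇}
  {u : Functor U B} {u̇ : Functor U̇ B} {Σ' : Functor U̇ U} {Δ : Functor U U̇}
  {adj : Adjunction Σ' Δ} (G : IsGCwF B u u̇ Σ' Δ adj) where
  private
    module B = Category B
    module U = Category U
    module U̇ = Category U̇
    module u = Functor u
    module S = Functor Σ'
    module Δ = Functor Δ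
    module uΣ = Functor (u ∘F Σ')
    module uΣΔ = Functor (u ∘F (Σ' ∘F Δ))
    module BE {X Y} = IsEquivalence (B.equiv {X} {Y})
    module UE {X Y} = IsEquivalence (U.equiv {X} {Y})
    module Fu = Fibred u
  open IsGCwF G
  open Adjunction adj
  open HomEq B
  open VObj using (dom; cod; arr; vert)
  open VHom using (top; bot)

  module VU = VerticalComma B u u (IdF U) (λ _ → ≈̂-refl)
  module VS = VerticalComma B u u̇ Σ' (λ m → heq (Σ-over₀ _) (Σ-over₀ _) (Σ-over₁ m))

  Σ̄ : Functor (VComma u Σ') (VComma u (IdF U))
  Σ̄ = record
    { F₀ = λ x → vobj (S.F₀ (dom x)) (cod x) (arr x) (vert x)
    ; F₁ = λ f → vhom (S.F₁ (top f)) (bot f) (VHom.comm f)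
    ; identity = S.identity , UE.refl
    ; homomorphism = S.homomorphism , UE.refl
    ; F-resp-≈ = λ (top≈ , bot≈) → S.F-resp-≈ top≈ , bot≈
    }
  private module Σ̄ = Functor Σ̄

  module Δ̄₀ (Y : VObj u (IdF U)) where
    private
      A' : U.Obj
      A' = dom Y
      A : U.Obj
      A = cod Y
      f : A' U.⇒ A
      f = arr Y
      module L = Fu.CartesianLift
        (Fu.cartesianLift u-fibration A (B.hom-subst refl (proj₁ (vert Y)) (u.F₁ (ε A'))))

    c-domain : U.Obj
    c-domain = L.obj

    c : c-domain U.⇒ A
    c = L.arr

    c-cartesian : IsCartesian u c
    c-cartesian = L.cartesian

    c-over : u.F₁ c ≈̂ u.F₁ (ε A')
    c-over = ≈̂-trans L.over (hom-subst-≈̂ refl (proj₁ (vert Y)) _)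

    private
      module G = Fu.Factorisation (Fu.factorise c-cartesian c-over (f U.∘ ε A') {B.id}
        (≈̂-trans identityʳ̂ (≈̂-sym (Fu.F₁-∘-verticalˡ (vert Y)))))

    g : S.F₀ (Δ.F₀ A') U.⇒ c-domain
    g = G.arr

    g-factors : c U.∘ g U.≈ f U.∘ ε A'
    g-factors = G.factors

    g-vertical : IsVertical u g
    g-vertical = Fu.≈̂id⇒vertical G.over

    obj : VObj u Σ'
    obj = vobj (Δ.F₀ A') c-domain g g-vertical

  module Δ̄₁ {Y₁ Y₂ : VObj u (IdF U)} (φ : VHom u (IdF U) Y₁ Y₂) where
    private
      module D₁ = Δ̄₀ Y₁
      module D₂ = Δ̄₀ Y₂
      h : dom Y₁ U.⇒ dom Y₂
      h = top φ
      k : cod Y₁ U.⇒ cod Y₂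
      k = bot φ
      module K = Fu.Factorisation (Fu.factorise D₂.c-cartesian D₂.c-over (k U.∘ D₁.c) {uΣΔ.F₁ h}
        (u.F₁ (ε (dom Y₂)) B.∘ uΣΔ.F₁ h      ≈̂⟨ ≈̂-sym Fu.homomorphism̂ ⟩
         u.F₁ (ε (dom Y₂) U.∘ S.F₁ (Δ.F₁ h)) ≈̂⟨ ≈⇒≈̂ (u.F-resp-≈ (ε-natural h)) ⟩
         u.F₁ (h U.∘ ε (dom Y₁))             ≈̂⟨ Fu.homomorphism̂ ⟩
         u.F₁ h B.∘ u.F₁ (ε (dom Y₁))        ≈̂⟨ ∘-resp-≈̂ (≈̂-sym (VU.bot-≈̂-top φ)) (≈̂-sym D₁.c-over) ⟩
         u.F₁ k B.∘ u.F₁ D₁.c                ≈̂⟨ ≈̂-sym Fu.homomorphism̂ ⟩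
         u.F₁ (k U.∘ D₁.c)                   ∎̂))

    k̄ : Δ̄₀.c-domain Y₁ U.⇒ Δ̄₀.c-domain Y₂
    k̄ = K.arr

    k̄-over : u.F₁ k̄ ≈̂ uΣΔ.F₁ h
    k̄-over = K.over

    k̄-factors : D₂.c U.∘ k̄ U.≈ k U.∘ D₁.c
    k̄-factors = K.factors

    k̄-unique : ∀ {n} → u.F₁ n ≈̂ uΣΔ.F₁ h → D₂.c U.∘ n U.≈ k U.∘ D₁.c → n U.≈ k̄
    k̄-unique n-over n-factors =
      Fu.cartesian-unique D₂.c-cartesian
        (≈̂-trans n-over (≈̂-sym K.over)) (UE.trans n-factors (UE.sym K.factors))

    comm : k̄ U.∘ D₁.g U.≈ D₂.g U.∘ S.F₁ (Δ.F₁ h)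
    comm = Fu.cartesian-unique D₂.c-cartesian
      (≈̂-trans (Fu.F₁-∘-verticalʳ D₁.g-vertical)
        (≈̂-trans K.over (≈̂-sym (Fu.F₁-∘-verticalˡ D₂.g-vertical))))
      (begin
        D₂.c U.∘ (k̄ U.∘ D₁.g)                     ≈⟨ UE.sym U.assoc ⟩
        (D₂.c U.∘ k̄) U.∘ D₁.g                     ≈⟨ U.∘-resp-≈ K.factors UE.refl ⟩
        (k U.∘ D₁.c) U.∘ D₁.g                     ≈⟨ U.assoc ⟩
        k U.∘ (D₁.c U.∘ D₁.g)                     ≈⟨ U.∘-resp-≈ UE.refl D₁.g-factors ⟩
        k U.∘ (arr Y₁ U.∘ ε (dom Y₁))             ≈⟨ UE.sym U.assoc ⟩
        (k U.∘ arr Y₁) U.∘ ε (dom Y₁)             ≈⟨ U.∘-resp-≈ (VHom.comm φ) UE.refl ⟩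
        (arr Y₂ U.∘ h) U.∘ ε (dom Y₁)             ≈⟨ U.assoc ⟩
        arr Y₂ U.∘ (h U.∘ ε (dom Y₁))             ≈⟨ U.∘-resp-≈ UE.refl (UE.sym (ε-natural h)) ⟩
        arr Y₂ U.∘ (ε (dom Y₂) U.∘ S.F₁ (Δ.F₁ h)) ≈⟨ UE.sym U.assoc ⟩
        (arr Y₂ U.∘ ε (dom Y₂)) U.∘ S.F₁ (Δ.F₁ h) ≈⟨ U.∘-resp-≈ (UE.sym D₂.g-factors) UE.refl ⟩
        (D₂.c U.∘ D₂.g) U.∘ S.F₁ (Δ.F₁ h)         ≈⟨ U.assoc ⟩
        D₂.c U.∘ (D₂.g U.∘ S.F₁ (Δ.F₁ h))         ∎)
      where open SetoidR (U.hom-setoid _ _)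

    hom : VHom u Σ' D₁.obj D₂.obj
    hom = vhom (Δ.F₁ h) k̄ comm

  Δ̄ : Functor (VComma u (IdF U)) (VComma u Σ')
  Δ̄ = record
    { F₀ = Δ̄₀.obj
    ; F₁ = Δ̄₁.hom
    ; identity = λ {Y} → Δ.identity , UE.sym (k̄-id Y)
    ; homomorphism = λ {_} {_} {_} {φ₁} {φ₂} → Δ.homomorphism , UE.sym (k̄-∘ φ₁ φ₂)
    ; F-resp-≈ = λ {_} {_} {φ} {φ'} φ≈φ' → Δ.F-resp-≈ (proj₁ φ≈φ') , k̄-resp φ φ' φ≈φ'
    }
    where
    open Δ̄₀ using (c; c-over)
    open Δ̄₁ using (k̄; k̄-over; k̄-factors; k̄-unique)

    k̄-id : ∀ Y → U.id U.≈ k̄ (Category.id (VComma u (IdF U)) {Y})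
    k̄-id Y = k̄-unique _
      (u.F₁ U.id   ≈̂⟨ Fu.identitŷ ⟩
       B.id        ≈̂⟨ id-≈̂ (dom-≡ (c-over Y)) ⟩
       B.id        ≈̂⟨ ≈⇒≈̂ (BE.sym (BE.trans (uΣ.F-resp-≈ Δ.identity) uΣ.identity)) ⟩
       uΣΔ.F₁ U.id ∎̂)
      (UE.trans U.identityʳ (UE.sym U.identityˡ))

    k̄-∘ : ∀ {Y₁ Y₂ Y₃} (φ₁ : VHom u (IdF U) Y₁ Y₂) (φ₂ : VHom u (IdF U) Y₂ Y₃) →
          k̄ φ₂ U.∘ k̄ φ₁ U.≈ k̄ (Category._∘_ (VComma u (IdF U)) φ₂ φ₁)
    k̄-∘ {Y₁} {Y₂} {Y₃} φ₁ φ₂ = k̄-unique (Category._∘_ (VComma u (IdF U)) φ₂ φ₁)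
      (u.F₁ (k̄ φ₂ U.∘ k̄ φ₁)                ≈̂⟨ Fu.homomorphism̂ ⟩
       u.F₁ (k̄ φ₂) B.∘ u.F₁ (k̄ φ₁)         ≈̂⟨ ∘-resp-≈̂ (k̄-over φ₂) (k̄-over φ₁) ⟩
       uΣΔ.F₁ (top φ₂) B.∘ uΣΔ.F₁ (top φ₁) ≈̂⟨ ≈⇒≈̂ (BE.sym uΣΔ.homomorphism) ⟩
       uΣΔ.F₁ (top φ₂ U.∘ top φ₁)          ∎̂)
      (begin
        c Y₃ U.∘ (k̄ φ₂ U.∘ k̄ φ₁)     ≈⟨ UE.sym U.assoc ⟩
        (c Y₃ U.∘ k̄ φ₂) U.∘ k̄ φ₁     ≈⟨ U.∘-resp-≈ (k̄-factors φ₂) UE.refl ⟩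
        (bot φ₂ U.∘ c Y₂) U.∘ k̄ φ₁   ≈⟨ U.assoc ⟩
        bot φ₂ U.∘ (c Y₂ U.∘ k̄ φ₁)   ≈⟨ U.∘-resp-≈ UE.refl (k̄-factors φ₁) ⟩
        bot φ₂ U.∘ (bot φ₁ U.∘ c Y₁) ≈⟨ UE.sym U.assoc ⟩
        (bot φ₂ U.∘ bot φ₁) U.∘ c Y₁ ∎)
      where open SetoidR (U.hom-setoid _ _)

    k̄-resp : ∀ {Y₁ Y₂} (φ φ' : VHom u (IdF U) Y₁ Y₂) →
             Category._≈_ (VComma u (IdF U)) φ φ' → k̄ φ U.≈ k̄ φ'
    k̄-resp φ φ' (top≈ , bot≈) = k̄-unique φ'
      (≈̂-trans (k̄-over φ) (≈⇒≈̂ (uΣΔ.F-resp-≈ top≈)))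
      (UE.trans (k̄-factors φ) (U.∘-resp-≈ bot≈ UE.refl))
  private module Δ̄ = Functor Δ̄

  module η̄ (x : VObj u Σ') where
    private
      a : U̇.Obj
      a = dom x
      module D = Δ̄₀ (Σ̄.F₀ x)
      module N = Fu.Factorisation (Fu.factorise D.c-cartesian D.c-over U.id {uΣ.F₁ (η a)}
        (u.F₁ (ε (S.F₀ a)) B.∘ uΣ.F₁ (η a) ≈̂⟨ ≈̂-sym Fu.homomorphism̂ ⟩
         u.F₁ (ε (S.F₀ a) U.∘ S.F₁ (η a))  ≈̂⟨ ≈⇒≈̂ (BE.trans (u.F-resp-≈ zig) u.identity) ⟩
         B.id                              ≈̂⟨ id-≈̂ (proj₁ (vert x)) ⟩
         B.id                              ≈̂⟨ ≈̂-sym Fu.identitŷ ⟩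
         u.F₁ U.id                         ∎̂))

    n̄ : cod x U.⇒ D.c-domain
    n̄ = N.arr

    n̄-over : u.F₁ n̄ ≈̂ uΣ.F₁ (η a)
    n̄-over = N.over

    n̄-section : D.c U.∘ n̄ U.≈ U.id
    n̄-section = N.factors

    comm : n̄ U.∘ arr x U.≈ D.g U.∘ S.F₁ (η a)
    comm = Fu.cartesian-unique D.c-cartesian
      (≈̂-trans (Fu.F₁-∘-verticalʳ (vert x)) (≈̂-trans N.over (≈̂-sym (Fu.F₁-∘-verticalˡ D.g-vertical))))
      (begin
        D.c U.∘ (n̄ U.∘ arr x)                 ≈⟨ UE.sym U.assoc ⟩
        (D.c U.∘ n̄) U.∘ arr x                 ≈⟨ U.∘-resp-≈ N.factors UE.refl ⟩
        U.id U.∘ arr x                        ≈⟨ U.identityˡ ⟩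
        arr x                                 ≈⟨ UE.sym U.identityʳ ⟩
        arr x U.∘ U.id                        ≈⟨ U.∘-resp-≈ UE.refl (UE.sym zig) ⟩
        arr x U.∘ (ε (S.F₀ a) U.∘ S.F₁ (η a)) ≈⟨ UE.sym U.assoc ⟩
        (arr x U.∘ ε (S.F₀ a)) U.∘ S.F₁ (η a) ≈⟨ U.∘-resp-≈ (UE.sym D.g-factors) UE.refl ⟩
        (D.c U.∘ D.g) U.∘ S.F₁ (η a)          ≈⟨ U.assoc ⟩
        D.c U.∘ (D.g U.∘ S.F₁ (η a))          ∎)
      where open SetoidR (U.hom-setoid _ _)

    hom : VHom u Σ' x (Δ̄.F₀ (Σ̄.F₀ x))
    hom = vhom (η a) n̄ comm

  ε̄ : ∀ Y → VHom u (IdF U) (Σ̄.F₀ (Δ̄.F₀ Y)) Y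
  ε̄ Y = vhom (ε (dom Y)) (Δ̄₀.c Y) (Δ̄₀.g-factors Y)

  open Δ̄₀ using (c; c-cartesian; c-over)
  open η̄ using (n̄; n̄-over)
  open Δ̄₁ using (k̄; k̄-over; k̄-factors)

  n̄-natural : ∀ {x₁ x₂} (φ : VHom u Σ' x₁ x₂) →
              n̄ x₂ U.∘ bot φ U.≈ k̄ (Σ̄.F₁ φ) U.∘ n̄ x₁
  n̄-natural {x₁} {x₂} φ = Fu.cartesian-unique (c-cartesian (Σ̄.F₀ x₂))
    (u.F₁ (n̄ x₂ U.∘ bot φ)                        ≈̂⟨ Fu.homomorphism̂ ⟩
     u.F₁ (n̄ x₂) B.∘ u.F₁ (bot φ)                 ≈̂⟨ ∘-resp-≈̂ (n̄-over x₂) (VS.bot-≈̂-F₁-top φ) ⟩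
     uΣ.F₁ (η (dom x₂)) B.∘ uΣ.F₁ (top φ)         ≈̂⟨ ≈⇒≈̂ (BE.sym uΣ.homomorphism) ⟩
     uΣ.F₁ (η (dom x₂) U̇.∘ top φ)                 ≈̂⟨ ≈⇒≈̂ (uΣ.F-resp-≈ (η-natural (top φ))) ⟩
     uΣ.F₁ (Δ.F₁ (S.F₁ (top φ)) U̇.∘ η (dom x₁))   ≈̂⟨ ≈⇒≈̂ uΣ.homomorphism ⟩
     uΣΔ.F₁ (S.F₁ (top φ)) B.∘ uΣ.F₁ (η (dom x₁)) ≈̂⟨ ∘-resp-≈̂ (≈̂-sym (k̄-over (Σ̄.F₁ φ))) (≈̂-sym (n̄-over x₁)) ⟩
     u.F₁ (k̄ (Σ̄.F₁ φ)) B.∘ u.F₁ (n̄ x₁)            ≈̂⟨ ≈̂-sym Fu.homomorphism̂ ⟩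
     u.F₁ (k̄ (Σ̄.F₁ φ) U.∘ n̄ x₁)                   ∎̂)
    (begin
      c (Σ̄.F₀ x₂) U.∘ (n̄ x₂ U.∘ bot φ)      ≈⟨ UE.sym U.assoc ⟩
      (c (Σ̄.F₀ x₂) U.∘ n̄ x₂) U.∘ bot φ      ≈⟨ U.∘-resp-≈ (η̄.n̄-section x₂) UE.refl ⟩
      U.id U.∘ bot φ                        ≈⟨ U.identityˡ ⟩
      bot φ                                 ≈⟨ UE.sym U.identityʳ ⟩
      bot φ U.∘ U.id                        ≈⟨ U.∘-resp-≈ UE.refl (UE.sym (η̄.n̄-section x₁)) ⟩
      bot φ U.∘ (c (Σ̄.F₀ x₁) U.∘ n̄ x₁)      ≈⟨ UE.sym U.assoc ⟩
      (bot φ U.∘ c (Σ̄.F₀ x₁)) U.∘ n̄ x₁      ≈⟨ U.∘-resp-≈ (UE.sym (k̄-factors (Σ̄.F₁ φ))) UE.refl ⟩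
      (c (Σ̄.F₀ x₂) U.∘ k̄ (Σ̄.F₁ φ)) U.∘ n̄ x₁ ≈⟨ U.assoc ⟩
      c (Σ̄.F₀ x₂) U.∘ (k̄ (Σ̄.F₁ φ) U.∘ n̄ x₁) ∎)
    where open SetoidR (U.hom-setoid _ _)

  k̄-n̄-zag : ∀ Y → k̄ (ε̄ Y) U.∘ n̄ (Δ̄.F₀ Y) U.≈ U.id
  k̄-n̄-zag Y = Fu.cartesian-unique (c-cartesian Y)
    (u.F₁ (k̄ (ε̄ Y) U.∘ n̄ (Δ̄.F₀ Y))         ≈̂⟨ Fu.homomorphism̂ ⟩
     u.F₁ (k̄ (ε̄ Y)) B.∘ u.F₁ (n̄ (Δ̄.F₀ Y))  ≈̂⟨ ∘-resp-≈̂ (k̄-over (ε̄ Y)) (n̄-over (Δ̄.F₀ Y)) ⟩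
     uΣΔ.F₁ (ε A') B.∘ uΣ.F₁ (η (Δ.F₀ A')) ≈̂⟨ ≈⇒≈̂ (BE.sym uΣ.homomorphism) ⟩
     uΣ.F₁ (Δ.F₁ (ε A') U̇.∘ η (Δ.F₀ A'))   ≈̂⟨ ≈⇒≈̂ (BE.trans (uΣ.F-resp-≈ zag) uΣ.identity) ⟩
     B.id                                  ≈̂⟨ id-≈̂ (sym (dom-≡ (c-over Y))) ⟩
     B.id                                  ≈̂⟨ ≈̂-sym Fu.identitŷ ⟩
     u.F₁ U.id                             ∎̂)
    (begin
      c Y U.∘ (k̄ (ε̄ Y) U.∘ n̄ (Δ̄.F₀ Y))           ≈⟨ UE.sym U.assoc ⟩
      (c Y U.∘ k̄ (ε̄ Y)) U.∘ n̄ (Δ̄.F₀ Y)           ≈⟨ U.∘-resp-≈ (k̄-factors (ε̄ Y)) UE.refl ⟩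
      (c Y U.∘ c (Σ̄.F₀ (Δ̄.F₀ Y))) U.∘ n̄ (Δ̄.F₀ Y) ≈⟨ U.assoc ⟩
      c Y U.∘ (c (Σ̄.F₀ (Δ̄.F₀ Y)) U.∘ n̄ (Δ̄.F₀ Y)) ≈⟨ U.∘-resp-≈ UE.refl (η̄.n̄-section (Δ̄.F₀ Y)) ⟩
      c Y U.∘ U.id                               ∎)
    where
    A' : U.Obj
    A' = dom Y
    open SetoidR (U.hom-setoid _ _)

  adjunction : Adjunction Σ̄ Δ̄
  adjunction = record
    { η = η̄.hom
    ; ε = ε̄
    ; η-natural = λ {x₁} {x₂} φ → η-natural (top φ) , n̄-natural {x₁} {x₂} φ
    ; ε-natural = λ {Y₁} {Y₂} φ → ε-natural (top φ) , Δ̄₁.k̄-factors {Y₁} {Y₂} φ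
    ; zig = λ {x} → zig , η̄.n̄-section x
    ; zag = λ {Y} → zag , k̄-n̄-zag Y
    }

  Σ̄-cartesian : ∀ {x y} (f : VHom u Σ' x y) → IsCartesian (VCommaProj u Σ') f →
                IsCartesian (VCommaProj u (IdF U)) (Σ̄.F₁ f)
  Σ̄-cartesian {x} {y} f f-cart =
    VU.vhom-cartesian {x = Σ̄.F₀ x} {y = Σ̄.F₀ y} (Σ̄.F₁ f)
      (Σ-cartesian (top f) (proj₁ components)) (proj₂ components)
    where
    components : IsCartesian u̇ (top f) × IsCartesian u (bot f)
    components = VS.cartesian⇒top-cartesian×bot-cartesian u̇-fibration u-fibration {f = f} f-cart

  isGCwF : IsGCwF B (VCommaProj u (IdF U)) (VCommaProj u Σ') Σ̄ Δ̄ adjunction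
  isGCwF = record
    { terminal = terminal
    ; u-fibration = VU.isFibration u-fibration u-fibration
    ; u̇-fibration = VS.isFibration u̇-fibration u-fibration
    ; Σ-over₀ = λ _ → refl
    ; Σ-over₁ = λ _ → BE.refl
    ; Σ-cartesian = Σ̄-cartesian
    ; unit-cart = unit-cartesian
    ; counit-cart = λ Y →
        VU.vhom-cartesian {x = Σ̄.F₀ (Δ̄.F₀ Y)} {y = Y} (ε̄ Y) (counit-cart (dom Y)) (c-cartesian Y)
    }
    where
    unit-cartesian : ∀ x → IsCartesian (VCommaProj u Σ') (η̄.hom x)
    unit-cartesian x = VS.vhom-cartesian {x = x} {y = Δ̄.F₀ (Σ̄.F₀ x)} (η̄.hom x) (unit-cart (dom x))
      (Fu.cartesian-cancelˡ {c = c (Σ̄.F₀ x)} {f = n̄ x} (c-cartesian (Σ̄.F₀ x))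
        (Fu.cartesian-resp-≈ (UE.sym (η̄.n̄-section x)) Fu.id-cartesian))

proposition4p2 : ∀ {ob ℓb eb ou ℓu eu ou̇ ℓu̇ eu̇ : Level}
    (B : Category ob ℓb eb) (U : Category ou ℓu eu) (U̇ : Category ou̇ ℓu̇ eu̇)
    (u : Functor U B) (u̇ : Functor U̇ B)
    (Σ' : Functor U̇ U) (Δ : Functor U U̇) (adj : Adjunction Σ' Δ) →
    IsGCwF B u u̇ Σ' Δ adj →
    Σ[ Σ̄ ∈ Functor (VComma u Σ') (VComma u (IdF U)) ]
    Σ[ Δ̄ ∈ Functor (VComma u (IdF U)) (VComma u Σ') ]
    Σ[ adj̄ ∈ Adjunction Σ̄ Δ̄ ]
      IsGCwF B (VCommaProj u (IdF U)) (VCommaProj u Σ') Σ̄ Δ̄ adj̄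
proposition4p2 B U U̇ u u̇ Σ' Δ adj G = Σ̄ , Δ̄ , adjunction , isGCwF
  where open VerticalArrowCwF G
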